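{- Let $M$ be a monoid with identity $1$, let $p\geq 2$, and let $\tau_1,\dots,\tau_{p-1}\in M$ satisfy $\tau_i^2=1$ for $1\leq i\leq p-1$ and $\tau_i\tau_j=\tau_j\tau_i$ whenever $|i-j|>1$. For $1\le i\le p-1$ write $$\delta_i=\tau_1\tau_2\cdots\tau_i,\qquad \delta_i^*=\tau_i\tau_{i-1}\cdots\tau_1.$$ Let $u,v\in M$ and let $j\geq 1$ be an integer with $2j-1\leq p-1$. Then the following two conditions are equivalent: (i) $u\,\delta_1^*\delta_3^*\cdots\delta_{2j-1}^*=v\,\delta_1^*\delta_3^*\cdots\delta_{2j-1}^*\cdot\delta_{2j-1}\delta_{2j-2}\cdots\delta_2\delta_1$; (ii) $u\,\tau_1\tau_3\cdots\tau_{2j-1}=v$. -}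

module Defs where

open import Level using (Level)
open import Data.Nat using (ℕ; zero; suc; _+_; _*_)
open import Algebra.Bundles using (Monoid)

module _ {c ℓ : Level} (M : Monoid c ℓ) where
  open Monoid M

  δ : (ℕ → Carrier) → ℕ → Carrier
  δ τ zero    = ε
  δ τ (suc i) = δ τ i ∙ τ (suc i)

  δ* : (ℕ → Carrier) → ℕ → Carrier
  δ* τ zero    = ε
  δ* τ (suc i) = τ (suc i) ∙ δ* τ i

  oddStars : (ℕ → Carrier) → ℕ → Carrier
  oddStars τ zero    = ε
  oddStars τ (suc k) = oddStars τ k ∙ δ* τ (suc (2 * k))

  descDeltas : (ℕ → Carrier) → ℕ → Carrier
  descDeltas τ zero    = ε
  descDeltas τ (suc n) = δ τ (suc n) ∙ descDeltas τ n

  oddTaus : (ℕ → Carrier) → ℕ → Carrier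
  oddTaus τ zero    = ε
  oddTaus τ (suc k) = oddTaus τ k ∙ τ (suc (2 * k))

-- Write T = τ₁τ₃⋯τ_{2j-1}, X = δ*₁δ*₃⋯δ*_{2j-1} and D_n = δ_n⋯δ₂δ₁. The heart of the matter is
-- the identity T X = X D_{2j-1}, by induction on j: τ_{2j+1} commutes past X and cancels against
-- the leading factor of δ*_{2j+1} = τ_{2j+1} δ*_{2j}; then D_{2j-1} δ*_{2j} = D_{2j} (the far
-- commutation relations move τ_{n+1} across D_{n-1}) and δ*_{2j+1} δ_{2j+1} = 1 finish the step.
-- Moreover X is right invertible, each δ*_n having right inverse δ_n, and T² = 1 because T is a
-- product of commuting involutions. Hence (i) reads u X = v T X, that is u = v T, that is u T = v.

module Submission where

open import Defs
open import Level using (Level)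
open import Data.Nat using (ℕ; zero; suc; _+_; _*_; _∸_; _≤_; _<_; _>_; z≤n; s≤s)
open import Data.Nat.Properties using (≤-refl; ≤-trans; <⇒≤; n≤1+n; m∸n≤m; m+n≤o⇒n≤o; *-suc)
open import Data.Product using (∃; _,_)
open import Data.Sum using (_⊎_; inj₁)
open import Function.Bundles using (_⇔_; mk⇔)
open import Algebra.Bundles using (Monoid)
import Algebra.Properties.Monoid as MonoidProperties
import Relation.Binary.PropositionalEquality as ≡
open ≡ using (_≡_)
import Relation.Binary.Reasoning.Setoid as SetoidReasoning

2[1+k]∸1≡1+2k : ∀ k → 2 * suc k ∸ 1 ≡ suc (2 * k)
2[1+k]∸1≡1+2k k = ≡.cong (_∸ 1) (*-suc 2 k)

2[1+k]∸1≤⇒1+2k≤ : ∀ {k n} → 2 * suc k ∸ 1 ≤ n → suc (2 * k) ≤ n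
2[1+k]∸1≤⇒1+2k≤ {k} {n} = ≡.subst (_≤ n) (2[1+k]∸1≡1+2k k)

1+2k≤⇒2k∸1≤ : ∀ {k n} → suc (2 * k) ≤ n → 2 * k ∸ 1 ≤ n
1+2k≤⇒2k∸1≤ {k} h = ≤-trans (m∸n≤m (2 * k) 1) (<⇒≤ h)

2[1+k]<⇒3+2k≤ : ∀ {k n} → 2 * suc k < n → 2 + suc (2 * k) ≤ n
2[1+k]<⇒3+2k≤ {k} {n} = ≡.subst (λ m → suc m ≤ n) (*-suc 2 k)

module MonoidFacts {c ℓ : Level} (M : Monoid c ℓ) where
  open Monoid M
  open MonoidProperties M
  open SetoidReasoning setoid

  Commute : Carrier → Carrier → Set ℓ
  Commute a x = a ∙ x ≈ x ∙ a

  commute-ε : ∀ {a} → Commute a ε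
  commute-ε = ε-comm _

  commute-∙ : ∀ {a x y} → Commute a x → Commute a y → Commute a (x ∙ y)
  commute-∙ {a} {x} {y} ax≈xa ay≈ya = begin
    a ∙ (x ∙ y) ≈⟨ sym (assoc a x y) ⟩
    (a ∙ x) ∙ y ≈⟨ ∙-congʳ ax≈xa ⟩
    (x ∙ a) ∙ y ≈⟨ assoc x a y ⟩
    x ∙ (a ∙ y) ≈⟨ ∙-congˡ ay≈ya ⟩
    x ∙ (y ∙ a) ≈⟨ sym (assoc x y a) ⟩
    (x ∙ y) ∙ a ∎

  involutive-∙ : ∀ {a b} → a ∙ a ≈ ε → b ∙ b ≈ ε → Commute b a → (a ∙ b) ∙ (a ∙ b) ≈ ε
  involutive-∙ {a} {b} aa≈ε bb≈ε ba≈ab = begin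
    (a ∙ b) ∙ (a ∙ b) ≈⟨ uv∙wx≈u[vw∙x] a b a b ⟩
    a ∙ ((b ∙ a) ∙ b) ≈⟨ ∙-congˡ (∙-congʳ ba≈ab) ⟩
    a ∙ ((a ∙ b) ∙ b) ≈⟨ sym (assoc a (a ∙ b) b) ⟩
    (a ∙ (a ∙ b)) ∙ b ≈⟨ ∙-congʳ (cancelˡ aa≈ε b) ⟩
    b ∙ b             ≈⟨ bb≈ε ⟩
    ε                 ∎

  RightInvertible : Carrier → Set (c Level.⊔ ℓ)
  RightInvertible x = ∃ λ y → x ∙ y ≈ ε

  rightInvertible-ε : RightInvertible ε
  rightInvertible-ε = ε , identityˡ ε

  rightInvertible-∙ : ∀ {x y} → RightInvertible x → RightInvertible y → RightInvertible (x ∙ y)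
  rightInvertible-∙ {x} {y} (x′ , xx′≈ε) (y′ , yy′≈ε) =
    y′ ∙ x′ , trans (cancelᶜ yy′≈ε x x′) xx′≈ε

  rightInvertible⇒cancelʳ : ∀ {x u w} → RightInvertible x → u ∙ x ≈ w ∙ x → u ≈ w
  rightInvertible⇒cancelʳ {x} {u} {w} (x′ , xx′≈ε) ux≈wx = begin
    u             ≈⟨ insertʳ xx′≈ε u ⟩
    (u ∙ x) ∙ x′  ≈⟨ ∙-congʳ ux≈wx ⟩
    (w ∙ x) ∙ x′  ≈⟨ cancelʳ xx′≈ε w ⟩
    w             ∎

  intertwining⇔ : ∀ {x t d u v} → RightInvertible x → t ∙ t ≈ ε → t ∙ x ≈ x ∙ d →
                  (u ∙ x ≈ (v ∙ x) ∙ d) ⇔ (u ∙ t ≈ v)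
  intertwining⇔ {x} {t} {d} {u} {v} x-inv tt≈ε tx≈xd = mk⇔ to from
    where
    vxd≈vtx : (v ∙ x) ∙ d ≈ (v ∙ t) ∙ x
    vxd≈vtx = uv≈wx⇒yu∙v≈yw∙x (sym tx≈xd) v

    to : u ∙ x ≈ (v ∙ x) ∙ d → u ∙ t ≈ v
    to ux≈vxd = begin
      u ∙ t        ≈⟨ ∙-congʳ (rightInvertible⇒cancelʳ x-inv (trans ux≈vxd vxd≈vtx)) ⟩
      (v ∙ t) ∙ t  ≈⟨ cancelʳ tt≈ε v ⟩
      v            ∎

    from : u ∙ t ≈ v → u ∙ x ≈ (v ∙ x) ∙ d
    from ut≈v = begin
      u ∙ x              ≈⟨ ∙-congʳ (insertʳ tt≈ε u) ⟩
      ((u ∙ t) ∙ t) ∙ x  ≈⟨ ∙-congʳ (∙-congʳ ut≈v) ⟩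
      (v ∙ t) ∙ x        ≈⟨ sym vxd≈vtx ⟩
      (v ∙ x) ∙ d        ∎

module CoxeterRelations {c ℓ : Level} (M : Monoid c ℓ) (τ : ℕ → Monoid.Carrier M) (q : ℕ)
  (τ-involutive : ∀ i → 1 ≤ i → i ≤ q → Monoid._≈_ M (Monoid._∙_ M (τ i) (τ i)) (Monoid.ε M))
  (τ-farCommute : ∀ {i m} → 1 ≤ i → 2 + i ≤ m → m ≤ q → MonoidFacts.Commute M (τ m) (τ i))
  where
  open Monoid M
  open MonoidProperties M
  open MonoidFacts M
  open SetoidReasoning setoid
  open import Algebra.Solver.Monoid M using (solve; _⊜_; _⊕_; id)

  τ-commute-δ : ∀ {m} n → 2 + n ≤ m → m ≤ q → Commute (τ m) (δ M τ n)
  τ-commute-δ zero    _     _    = commute-ε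
  τ-commute-δ (suc n) 3+n≤m m≤q =
    commute-∙ (τ-commute-δ n (≤-trans (n≤1+n _) 3+n≤m) m≤q) (τ-farCommute (s≤s z≤n) 3+n≤m m≤q)

  τ-commute-δ* : ∀ {m} n → 2 + n ≤ m → m ≤ q → Commute (τ m) (δ* M τ n)
  τ-commute-δ* zero    _     _    = commute-ε
  τ-commute-δ* (suc n) 3+n≤m m≤q =
    commute-∙ (τ-farCommute (s≤s z≤n) 3+n≤m m≤q) (τ-commute-δ* n (≤-trans (n≤1+n _) 3+n≤m) m≤q)

  τ-commute-descDeltas : ∀ {m} n → 2 + n ≤ m → m ≤ q → Commute (τ m) (descDeltas M τ n)
  τ-commute-descDeltas zero    _     _    = commute-ε
  τ-commute-descDeltas (suc n) 3+n≤m m≤q =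
    commute-∙ (τ-commute-δ (suc n) 3+n≤m m≤q) (τ-commute-descDeltas n (≤-trans (n≤1+n _) 3+n≤m) m≤q)

  τ-commute-oddStars : ∀ {m} k → 2 * k < m → m ≤ q → Commute (τ m) (oddStars M τ k)
  τ-commute-oddStars zero    _     _    = commute-ε
  τ-commute-oddStars {m} (suc k) 2k+2<m m≤q =
    commute-∙ (τ-commute-oddStars k (m+n≤o⇒n≤o 2 3+2k≤m) m≤q) (τ-commute-δ* (suc (2 * k)) 3+2k≤m m≤q)
    where
    3+2k≤m : 2 + suc (2 * k) ≤ m
    3+2k≤m = 2[1+k]<⇒3+2k≤ 2k+2<m

  τ-commute-oddTaus : ∀ {m} k → 2 * k < m → m ≤ q → Commute (τ m) (oddTaus M τ k)
  τ-commute-oddTaus zero    _     _    = commute-ε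
  τ-commute-oddTaus {m} (suc k) 2k+2<m m≤q =
    commute-∙ (τ-commute-oddTaus k (m+n≤o⇒n≤o 2 3+2k≤m) m≤q) (τ-farCommute (s≤s z≤n) 3+2k≤m m≤q)
    where
    3+2k≤m : 2 + suc (2 * k) ≤ m
    3+2k≤m = 2[1+k]<⇒3+2k≤ 2k+2<m

  δ*∙δ≈ε : ∀ n → n ≤ q → δ* M τ n ∙ δ M τ n ≈ ε
  δ*∙δ≈ε zero    _   = identityˡ ε
  δ*∙δ≈ε (suc n) n<q = trans (cancelᶜ (δ*∙δ≈ε n (<⇒≤ n<q)) _ _) (τ-involutive (suc n) (s≤s z≤n) n<q)

  oddStars-rightInvertible : ∀ j → 2 * j ∸ 1 ≤ q → RightInvertible (oddStars M τ j)
  oddStars-rightInvertible zero    _ = rightInvertible-ε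
  oddStars-rightInvertible (suc k) h =
    rightInvertible-∙ (oddStars-rightInvertible k (1+2k≤⇒2k∸1≤ {k} 1+2k≤q)) (δ M τ (suc (2 * k)) , δ*∙δ≈ε _ 1+2k≤q)
    where
    1+2k≤q : suc (2 * k) ≤ q
    1+2k≤q = 2[1+k]∸1≤⇒1+2k≤ h

  oddTaus-involutive : ∀ j → 2 * j ∸ 1 ≤ q → oddTaus M τ j ∙ oddTaus M τ j ≈ ε
  oddTaus-involutive zero    _ = identityˡ ε
  oddTaus-involutive (suc k) h =
    involutive-∙ (oddTaus-involutive k (1+2k≤⇒2k∸1≤ {k} 1+2k≤q)) (τ-involutive _ (s≤s z≤n) 1+2k≤q)
                 (τ-commute-oddTaus k ≤-refl 1+2k≤q)
    where
    1+2k≤q : suc (2 * k) ≤ q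
    1+2k≤q = 2[1+k]∸1≤⇒1+2k≤ h

  descDeltas∙δ* : ∀ n → suc n ≤ q → descDeltas M τ n ∙ δ* M τ (suc n) ≈ descDeltas M τ (suc n)
  descDeltas∙δ* zero    _   = sym (assoc ε (τ 1) ε)
  descDeltas∙δ* (suc n) 2+n≤q = begin
    (δn+1 ∙ Dn) ∙ (t ∙ δ*n+1)  ≈⟨ uv∙wx≈u[vw∙x] δn+1 Dn t δ*n+1 ⟩
    δn+1 ∙ ((Dn ∙ t) ∙ δ*n+1)  ≈⟨ ∙-congˡ (∙-congʳ (sym (τ-commute-descDeltas n ≤-refl 2+n≤q))) ⟩
    δn+1 ∙ ((t ∙ Dn) ∙ δ*n+1)  ≈⟨ ∙-congˡ (assoc t Dn δ*n+1) ⟩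
    δn+1 ∙ (t ∙ (Dn ∙ δ*n+1))  ≈⟨ ∙-congˡ (∙-congˡ (descDeltas∙δ* n (<⇒≤ 2+n≤q))) ⟩
    δn+1 ∙ (t ∙ Dn+1)          ≈⟨ sym (assoc δn+1 t Dn+1) ⟩
    (δn+1 ∙ t) ∙ Dn+1          ∎
    where
    t δn+1 δ*n+1 Dn Dn+1 : Carrier
    t = τ (suc (suc n))
    δn+1 = δ M τ (suc n)
    δ*n+1 = δ* M τ (suc n)
    Dn = descDeltas M τ n
    Dn+1 = descDeltas M τ (suc n)

  oddTaus-intertwines-suc : ∀ k → suc (2 * k) ≤ q →
    oddTaus M τ (suc k) ∙ oddStars M τ (suc k) ≈ oddStars M τ (suc k) ∙ descDeltas M τ (suc (2 * k))
  oddTaus-intertwines-suc zero    _ =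
    solve 1 (λ t → (id ⊕ t) ⊕ (id ⊕ (t ⊕ id)) ⊜ (id ⊕ (t ⊕ id)) ⊕ ((id ⊕ t) ⊕ id)) refl (τ 1)
  oddTaus-intertwines-suc (suc k) 3+2k≤q = begin
    (T ∙ t) ∙ (X ∙ (t ∙ δ*N))  ≈⟨ uv∙wx≈u[vw∙x] T t X (t ∙ δ*N) ⟩
    T ∙ ((t ∙ X) ∙ (t ∙ δ*N))  ≈⟨ ∙-congˡ (∙-congʳ (τ-commute-oddStars (suc k) ≤-refl 3+2k≤q)) ⟩
    T ∙ ((X ∙ t) ∙ (t ∙ δ*N))  ≈⟨ ∙-congˡ (cancelᶜ (τ-involutive _ (s≤s z≤n) 3+2k≤q) X δ*N) ⟩
    T ∙ (X ∙ δ*N)              ≈⟨ sym (assoc T X δ*N) ⟩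
    (T ∙ X) ∙ δ*N              ≈⟨ ∙-congʳ (oddTaus-intertwines-suc k 1+2k≤q) ⟩
    (X ∙ D) ∙ δ*N              ≈⟨ assoc X D δ*N ⟩
    X ∙ (D ∙ δ*N)              ≈⟨ ∙-congˡ (descDeltas∙δ*-at (*-suc 2 k) (<⇒≤ 3+2k≤q)) ⟩
    X ∙ DN                     ≈⟨ ∙-congˡ (insertˡ (δ*∙δ≈ε (suc N) 3+2k≤q) DN) ⟩
    X ∙ (δ*c ∙ (δc ∙ DN))      ≈⟨ sym (assoc X δ*c (δc ∙ DN)) ⟩
    (X ∙ δ*c) ∙ (δc ∙ DN)      ∎
    where
    N : ℕ
    N = 2 * suc k
    t T X D δ*N DN δ*c δc : Carrier
    t = τ (suc N)
    T = oddTaus M τ (suc k)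
    X = oddStars M τ (suc k)
    D = descDeltas M τ (suc (2 * k))
    δ*N = δ* M τ N
    DN = descDeltas M τ N
    δ*c = δ* M τ (suc N)
    δc = δ M τ (suc N)

    1+2k≤q : suc (2 * k) ≤ q
    1+2k≤q = m+n≤o⇒n≤o 2 (2[1+k]<⇒3+2k≤ 3+2k≤q)

    descDeltas∙δ*-at : ∀ {n} → n ≡ suc (suc (2 * k)) → n ≤ q → D ∙ δ* M τ n ≈ descDeltas M τ n
    descDeltas∙δ*-at ≡.refl = descDeltas∙δ* (suc (2 * k))

  oddTaus-intertwines : ∀ j → 1 ≤ j → 2 * j ∸ 1 ≤ q →
    oddTaus M τ j ∙ oddStars M τ j ≈ oddStars M τ j ∙ descDeltas M τ (2 * j ∸ 1)
  oddTaus-intertwines (suc k) (s≤s z≤n) h =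
    ≡.subst (λ n → oddTaus M τ (suc k) ∙ oddStars M τ (suc k) ≈ oddStars M τ (suc k) ∙ descDeltas M τ n)
            (≡.sym (2[1+k]∸1≡1+2k k)) (oddTaus-intertwines-suc k (2[1+k]∸1≤⇒1+2k≤ h))

lemma3p2 : {c ℓ : Level} (M : Monoid c ℓ) (p : ℕ) → 2 ≤ p →
    (τ : ℕ → Monoid.Carrier M) →
    (∀ i → 1 ≤ i → i ≤ p ∸ 1 → Monoid._≈_ M (Monoid._∙_ M (τ i) (τ i)) (Monoid.ε M)) →
    (∀ i k → 1 ≤ i → i ≤ p ∸ 1 → 1 ≤ k → k ≤ p ∸ 1 → (i > suc k ⊎ k > suc i) →
      Monoid._≈_ M (Monoid._∙_ M (τ i) (τ k)) (Monoid._∙_ M (τ k) (τ i))) →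
    (u v : Monoid.Carrier M) (j : ℕ) → 1 ≤ j → 2 * j ∸ 1 ≤ p ∸ 1 →
    (Monoid._≈_ M (Monoid._∙_ M u (oddStars M τ j))
                  (Monoid._∙_ M (Monoid._∙_ M v (oddStars M τ j)) (descDeltas M τ (2 * j ∸ 1))))
    ⇔ (Monoid._≈_ M (Monoid._∙_ M u (oddTaus M τ j)) v)
lemma3p2 M p _ τ τ-involutive τ-commute u v j 1≤j 2j∸1≤q =
  intertwining⇔ (oddStars-rightInvertible j 2j∸1≤q) (oddTaus-involutive j 2j∸1≤q)
                (oddTaus-intertwines j 1≤j 2j∸1≤q)
  where
  open MonoidFacts M

  τ-farCommute : ∀ {i m} → 1 ≤ i → 2 + i ≤ m → m ≤ p ∸ 1 → Commute (τ m) (τ i)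
  τ-farCommute 1≤i 2+i≤m m≤q =
    τ-commute _ _ (≤-trans (s≤s z≤n) 2+i≤m) m≤q 1≤i (≤-trans (m+n≤o⇒n≤o 2 2+i≤m) m≤q) (inj₁ 2+i≤m)

  open CoxeterRelations M τ (p ∸ 1) τ-involutive τ-farCommute
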